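{- Let $G=(X,Y,E)$ be a chained complete bipartite graph with MCB-component family $\mathscr{C}=\{C_1,\dots,C_n\}$ labelled as in the definition. Then $$I(G)\ge \sum_{i=1}^{n}\Big(|X_i|\cdot|Y_i|+(|X_i|\bmod 2)\cdot(|Y_i|\bmod 2)\Big)-\sum_{i=1}^{n-1}\big(g(s_i,C_i)+g(s_i,C_{i+1})\big)+\sum_{i=1}^{n-1}\big|g(s_i,C_i)-g(s_i,C_{i+1})\big|.$$
   Context: All graphs are finite, simple, undirected and connected. For a graph $G=(V,E)$ and an ordering (bijection) $\sigma:V\to\{1,\dots,|V|\}$, $I(v,\sigma,G)=\big|\,|\{u\in N(v): \sigma(u)<\sigma(v)\}|-|\{u\in N(v): \sigma(u)>\sigma(v)\}|\,\big|$, $I(\sigma,G)=\sum_v I(v,\sigma,G)$, $I(G)=\min_\sigma I(\sigma,G)$. An MCB-component family of $G$ is a family $\mathscr{C}$ of vertex subsets such that every edge lies within some $C\in\mathscr{C}$, each $G[C]$ is complete bipartite, and for each $C\in\mathscr{C}$ and $v\notin C$, $G[C\cup\{v\}]$ is not complete bipartite. A bipartite graph $G=(X,Y,E)$ is a chained complete bipartite graph if it has an MCB-component family labelled $\mathscr{C}=\{C_1,\dots,C_n\}$ with $|C_i\cap C_{i+1}|=1$ for $1\le i<n$ and $C_i\cap C_j=\emptyset$ whenever $|i-j|>1$. The unique vertex of $C_i\cap C_{i+1}$ is denoted $s_i$. $X_i=X\cap C_i$, $Y_i=Y\cap C_i$. $g(s_i,C_j)=|N(s_i)\cap C_j|$,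 equal to $|Y_j|$ if $s_i\in X$ and $|X_j|$ if $s_i\in Y$. -}

module Defs where

open import Data.Bool using (Bool; true; false; if_then_else_; _∨_; _∧_; _xor_; not)
open import Data.Nat using (ℕ; zero; suc; _<ᵇ_; ∣_-_∣; _<_)
open import Data.Fin using (Fin; toℕ; _≟_)
open import Data.Fin.Permutation using (Permutation′; _⟨$⟩ʳ_)
open import Data.List using (List; allFin; map; upTo)
open import Data.Nat.ListAction using (sum)
open import Data.Product using (Σ; ∃; _×_; _,_)
open import Relation.Binary.PropositionalEquality using (_≡_; _≢_)
open import Relation.Nullary using (¬_)
open import Relation.Nullary.Decidable using (⌊_⌋)

record Graph (N : ℕ) : Set where
  field
    adj        : Fin N → Fin N → Bool
    adj-sym    : ∀ u v → adj u v ≡ adj v u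
    adj-irrefl : ∀ v → adj v v ≡ false
open Graph public

data Reach {N : ℕ} (G : Graph N) : Fin N → Fin N → Set where
  here : ∀ {v} → Reach G v v
  step : ∀ {u w v} → adj G u w ≡ true → Reach G w v → Reach G u v

Connected : ∀ {N} → Graph N → Set
Connected {N} G = ∀ (u v : Fin N) → Reach G u v

VSet : ℕ → Set
VSet N = Fin N → Bool

card : ∀ {N} → VSet N → ℕ
card {N} P = sum (map (λ u → if P u then 1 else 0) (allFin N))

sumTo : ℕ → (ℕ → ℕ) → ℕ
sumTo n f = sum (map f (upTo n))

before : ∀ {N} → Permutation′ N → Fin N → Fin N → Bool
before σ u v = toℕ (σ ⟨$⟩ʳ u) <ᵇ toℕ (σ ⟨$⟩ʳ v)

Ivert : ∀ {N} → Graph N → Permutation′ N → Fin N → ℕ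
Ivert G σ v = ∣ card (λ u → adj G v u ∧ before σ u v) - card (λ u → adj G v u ∧ before σ v u) ∣

Iord : ∀ {N} → Graph N → Permutation′ N → ℕ
Iord {N} G σ = sum (map (Ivert G σ) (allFin N))

-- G = (X, Y, E) bipartite: side v ≡ true means v ∈ X, false means v ∈ Y.
IsBipartition : ∀ {N} → Graph N → VSet N → Set
IsBipartition G side = ∀ u v → adj G u v ≡ true → side u ≢ side v

IsCompleteBipartite : ∀ {N} → Graph N → VSet N → Set
IsCompleteBipartite {N} G C =
  Σ (VSet N) λ A →
    (∃ λ a → C a ≡ true × A a ≡ true) ×
    (∃ λ b → C b ≡ true × A b ≡ false) ×
    (∀ u v → C u ≡ true → C v ≡ true → adj G u v ≡ (A u xor A v))

insert : ∀ {N} → VSet N → Fin N → VSet N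
insert C v u = C u ∨ ⌊ u ≟ v ⌋

IsMCBFamily : ∀ {N} → Graph N → (n : ℕ) → (ℕ → VSet N) → Set
IsMCBFamily G n C =
  (∀ u v → adj G u v ≡ true → ∃ λ i → i < n × C i u ≡ true × C i v ≡ true) ×
  (∀ i → i < n → IsCompleteBipartite G (C i)) ×
  (∀ i → i < n → ∀ v → C i v ≡ false → ¬ IsCompleteBipartite G (insert (C i) v))

-- Chained structure (0-indexed: C 0, …, C (n-1)); s i is the unique vertex of
-- C i ∩ C (i+1), i.e. C i ∩ C (i+1) = {s i} (so |C i ∩ C (i+1)| = 1).
IsChained : ∀ {N} → Graph N → (n : ℕ) → (ℕ → VSet N) → (ℕ → Fin N) → Set
IsChained G n C s =
  IsMCBFamily G n C ×
  (∀ i → suc i < n → ∀ v →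
     ((C i v ∧ C (suc i) v) ≡ true → v ≡ s i) × (v ≡ s i → (C i v ∧ C (suc i) v) ≡ true)) ×
  (∀ i j → i < n → j < n → 1 < ∣ i - j ∣ → ∀ v → (C i v ∧ C j v) ≡ false)

sizeX : ∀ {N} → VSet N → VSet N → ℕ
sizeX side Ci = card (λ v → Ci v ∧ side v)

sizeY : ∀ {N} → VSet N → VSet N → ℕ
sizeY side Ci = card (λ v → Ci v ∧ not (side v))

g : ∀ {N} → Graph N → Fin N → VSet N → ℕ
g G w Cj = card (λ v → adj G w v ∧ Cj v)

module Submission where

-- For each component C_i pick a threshold position t_i of σ such that the vertices of C_i placed
-- before t_i contain at least half of X_i but less than half of Y_i, or the other way round; it
-- exists because the prefix counts grow by at most one vertex per position. Charging every vertex
-- of G[C_i] its out-degree if it is early and its in-degree if it is late shows that the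
-- imbalances inside G[C_i] sum to at least twice the number of early-to-late edges, and by the
-- choice of t_i that number is at least (|X_i||Y_i| + (|X_i| mod 2)(|Y_i| mod 2)) / 2. A vertex
-- lying in a single component has the same imbalance in G[C_i] as in G; at the linking vertex s_i
-- the imbalances in G[C_i] and G[C_(i+1)] exceed its imbalance in G by at most
-- 2 min(g(s_i,C_i), g(s_i,C_(i+1))) = g(s_i,C_i) + g(s_i,C_(i+1)) − |g(s_i,C_i) − g(s_i,C_(i+1))|.

open import Data.Bool using (Bool; true; false; not; _∧_; _∨_; _xor_; if_then_else_; T)
import Data.Bool as Bool using (_≟_)
open import Data.Bool.Properties using (¬-not; T-≡; ∧-comm; ∧-assoc; ∧-identityʳ; ∧-zeroʳ; not-involutive)
open import Data.Empty using (⊥-elim)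
open import Data.Fin as Fin using (Fin; toℕ; fromℕ<; _≟_)
import Data.Fin.Properties as Fin
open import Data.Fin.Permutation using (Permutation′; _⟨$⟩ʳ_; _⟨$⟩ˡ_; inverseˡ)
open import Data.Integer as ℤ using (_⊖_)
import Data.Integer.Properties as ℤ
open import Data.List using (allFin; tabulate; applyUpTo)
import Data.List as List using (map)
open import Data.List.Properties using (map-tabulate)
open import Data.Nat as ℕ
  using (ℕ; zero; suc; _+_; _*_; _∸_; _%_; _≤_; _<_; _≤?_; _<?_; _⊓_; ∣_-_∣; _<ᵇ_; _≡ᵇ_; z≤n; s≤s; s≤s⁻¹; z<s)
open import Data.Nat.DivMod using ([m+kn]%n≡m%n; m%n≤m; m%n<n)
open import Data.Nat.ListAction using () renaming (sum to listSum)
open import Data.Nat.Properties hiding (_≟_)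
open import Algebra.Properties.Semiring.Sum +-*-semiring
open import Data.Nat.Tactic.RingSolver using (solve-∀)
open import Data.Product using (∃; _×_; _,_; proj₁; proj₂)
open import Data.Sum using (_⊎_; inj₁; inj₂; [_,_]′)
import Data.Sum as Sum
open import Function using (_∘_; id)
open import Function.Bundles using (Equivalence)
open import Relation.Binary.PropositionalEquality
open import Relation.Nullary using (¬_; yes; no; does; _×-dec_)
open import Relation.Nullary.Decidable using (dec-true; dec-false)

open import Defs

𝟙 : Bool → ℕ
𝟙 b = if b then 1 else 0

𝟙≤1 : ∀ b → 𝟙 b ≤ 1
𝟙≤1 true  = ≤-refl
𝟙≤1 false = z≤n

𝟙-∧ : ∀ a b → 𝟙 (a ∧ b) ≡ 𝟙 a * 𝟙 b
𝟙-∧ true  b = sym (+-identityʳ (𝟙 b))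
𝟙-∧ false b = refl

𝟙-not : ∀ {b} → ¬ b ≡ true → 𝟙 b ≡ 0
𝟙-not b≢true = cong 𝟙 (¬-not b≢true)

𝟙+𝟙-not : ∀ b → 𝟙 b + 𝟙 (not b) ≡ 1
𝟙+𝟙-not true  = refl
𝟙+𝟙-not false = refl

if-𝟙 : ∀ b (m n : ℕ) → (if b then m else n) ≡ 𝟙 b * m + 𝟙 (not b) * n
if-𝟙 true  m n = sym (trans (+-identityʳ _) (+-identityʳ m))
if-𝟙 false m n = sym (+-identityʳ n)

𝟙-split-exclusive : ∀ a b₁ b₂ → (a ≡ true → b₁ ≡ not b₂) → 𝟙 (a ∧ b₁) + 𝟙 (a ∧ b₂) ≡ 𝟙 a
𝟙-split-exclusive false b₁ b₂    _ = refl
𝟙-split-exclusive true  b₁ true  h rewrite h refl = refl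
𝟙-split-exclusive true  b₁ false h rewrite h refl = refl

𝟙-∨-∧ : ∀ a b p → 𝟙 ((a ∨ b) ∧ p) ≤ 𝟙 (a ∧ p) + 𝟙 b
𝟙-∨-∧ true  b     p = m≤m+n (𝟙 p) (𝟙 b)
𝟙-∨-∧ false true  p = 𝟙≤1 p
𝟙-∨-∧ false false p = z≤n

𝟙-xor-split : ∀ dv du sv su a → (dv ≡ true → du ≡ true → a ≡ (sv xor su)) →
              𝟙 ((dv ∧ du) ∧ a) ≡ 𝟙 (dv ∧ sv) * 𝟙 (du ∧ not su) + 𝟙 (dv ∧ not sv) * 𝟙 (du ∧ su)
𝟙-xor-split false du    sv    su    a _ = refl
𝟙-xor-split true  false true  su    a _ = refl
𝟙-xor-split true  false false su    a _ = refl
𝟙-xor-split true  true  true  true  a h rewrite h refl refl = refl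
𝟙-xor-split true  true  true  false a h rewrite h refl refl = refl
𝟙-xor-split true  true  false true  a h rewrite h refl refl = refl
𝟙-xor-split true  true  false false a h rewrite h refl refl = refl

∧-true : ∀ {a b} → a ∧ b ≡ true → a ≡ true × b ≡ true
∧-true {true} b≡true = refl , b≡true

exactly-one : ∀ {a b : Bool} → a ≡ true ⊎ b ≡ true → ¬ (a ∧ b) ≡ true → b ≡ not a
exactly-one {true}  {true}  _         not-both = ⊥-elim (not-both refl)
exactly-one {true}  {false} _         _        = refl
exactly-one {false} {true}  _         _        = refl
exactly-one {false} {false} (inj₁ ()) _
exactly-one {false} {false} (inj₂ ()) _

<⇒<ᵇ≡true : ∀ {m n} → m < n → (m <ᵇ n) ≡ true
<⇒<ᵇ≡true m<n = Equivalence.to T-≡ (<⇒<ᵇ m<n)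

<ᵇ≡true⇒< : ∀ {m n} → (m <ᵇ n) ≡ true → m < n
<ᵇ≡true⇒< {m} {n} eq = <ᵇ⇒< m n (Equivalence.from T-≡ eq)

<ᵇ≡false⇒≥ : ∀ {m n} → (m <ᵇ n) ≡ false → n ≤ m
<ᵇ≡false⇒≥ eq = ≮⇒≥ (λ m<n → subst T eq (<⇒<ᵇ m<n))

≥⇒<ᵇ≡false : ∀ {m n} → n ≤ m → (m <ᵇ n) ≡ false
≥⇒<ᵇ≡false n≤m = ¬-not (λ eq → <⇒≱ (<ᵇ≡true⇒< eq) n≤m)

<ᵇ-suc : ∀ m t → (m <ᵇ suc t) ≡ ((m <ᵇ t) ∨ (m ≡ᵇ t))
<ᵇ-suc zero    zero    = refl
<ᵇ-suc zero    (suc t) = refl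
<ᵇ-suc (suc m) zero    = refl
<ᵇ-suc (suc m) (suc t) = <ᵇ-suc m t

_∩_ : ∀ {N} → VSet N → VSet N → VSet N
(P ∩ Q) v = P v ∧ Q v

∁ : ∀ {N} → VSet N → VSet N
∁ P v = not (P v)

sum-tabulate : ∀ {n} (f : Fin n → ℕ) → listSum (tabulate f) ≡ sum f
sum-tabulate {zero}  f = refl
sum-tabulate {suc n} f = cong (f Fin.zero +_) (sum-tabulate (f ∘ Fin.suc))

sum-allFin : ∀ {n} (f : Fin n → ℕ) → listSum (List.map f (allFin n)) ≡ sum f
sum-allFin f = trans (cong listSum (map-tabulate id f)) (sum-tabulate f)

card-∑ : ∀ {N} (P : VSet N) → card P ≡ ∑[ u < N ] 𝟙 (P u)
card-∑ P = sum-allFin (𝟙 ∘ P)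

sum-applyUpTo : ∀ n (g f : ℕ → ℕ) → listSum (List.map f (applyUpTo g n)) ≡ ∑[ i < n ] f (g (toℕ i))
sum-applyUpTo zero    g f = refl
sum-applyUpTo (suc n) g f = cong (f (g 0) +_) (sum-applyUpTo n (g ∘ suc) f)

sumTo-∑ : ∀ n f → sumTo n f ≡ ∑[ i < n ] f (toℕ i)
sumTo-∑ n f = sum-applyUpTo n id f

sum-mono-≤ : ∀ {n} {f g : Fin n → ℕ} → (∀ i → f i ≤ g i) → sum f ≤ sum g
sum-mono-≤ {zero}  f≤g = z≤n
sum-mono-≤ {suc n} f≤g = +-mono-≤ (f≤g Fin.zero) (sum-mono-≤ (f≤g ∘ Fin.suc))

sum-zero : ∀ {n} {f : Fin n → ℕ} → (∀ i → f i ≡ 0) → sum f ≡ 0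
sum-zero {zero}  f≡0 = refl
sum-zero {suc n} f≡0 = cong₂ _+_ (f≡0 Fin.zero) (sum-zero (f≡0 ∘ Fin.suc))

sum-single : ∀ {n} {f : Fin n → ℕ} i → (∀ j → j ≢ i → f j ≡ 0) → sum f ≡ f i
sum-single {f = f} Fin.zero others =
  trans (cong (f Fin.zero +_) (sum-zero (λ j → others (Fin.suc j) λ ()))) (+-identityʳ _)
sum-single {f = f} (Fin.suc i) others =
  trans (cong (_+ sum (f ∘ Fin.suc)) (others Fin.zero λ ()))
        (sum-single i (λ j j≢i → others (Fin.suc j) (j≢i ∘ Fin.suc-injective)))

∑-+-*ˡ : ∀ {n} k (f g : Fin n → ℕ) → ∑[ i < n ] (f i + k * g i) ≡ sum f + k * sum g
∑-+-*ˡ k f g = trans (∑-distrib-+ f (λ i → k * g i)) (cong (sum f +_) (sym (*-distribˡ-sum k g)))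

∑∑-* : ∀ {m n} (f : Fin m → ℕ) (g : Fin n → ℕ) → ∑[ i < m ] ∑[ j < n ] (f i * g j) ≡ sum f * sum g
∑∑-* f g = trans (sum-cong-≗ (λ i → sym (*-distribˡ-sum (f i) g))) (sym (*-distribʳ-sum (sum g) f))

unique⇒∑𝟙≤1 : ∀ {N} (P : VSet N) → (∀ u v → P u ≡ true → P v ≡ true → u ≡ v) → ∑[ u < N ] 𝟙 (P u) ≤ 1
unique⇒∑𝟙≤1 P unique with Fin.any? (λ u → P u Bool.≟ true)
... | yes (u , Pu) = ≤-trans (≤-reflexive (sum-single u (λ v v≢u → 𝟙-not (v≢u ∘ λ Pv → unique v u Pv Pu))))
                             (𝟙≤1 (P u))
... | no none      = ≤-trans (≤-reflexive (sum-zero (λ v → 𝟙-not (λ Pv → none (v , Pv))))) z≤n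

∑-toℕ-single : ∀ {n} i {f : ℕ → ℕ} → i < n → (∀ j → j < n → j ≢ i → f j ≡ 0) →
               ∑[ j < n ] f (toℕ j) ≡ f i
∑-toℕ-single i {f} i<n others =
  trans (sum-single (fromℕ< i<n) (λ j j≢i → others (toℕ j) (Fin.toℕ<n j) (j≢i ∘ toℕ≡i)))
        (cong f (Fin.toℕ-fromℕ< i<n))
  where
  toℕ≡i : ∀ {j} → toℕ j ≡ i → j ≡ fromℕ< i<n
  toℕ≡i eq = Fin.toℕ-injective (trans eq (sym (Fin.toℕ-fromℕ< i<n)))

∑-toℕ-pair : ∀ {n} i {f : ℕ → ℕ} → suc i < n → (∀ j → j < n → j ≢ i → j ≢ suc i → f j ≡ 0) →
             ∑[ j < n ] f (toℕ j) ≡ f i + f (suc i)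
∑-toℕ-pair {suc n} zero    {f} (s≤s 1≤n) others =
  cong (f 0 +_) (∑-toℕ-single 0 1≤n (λ j j<n j≢0 → others (suc j) (s≤s j<n) (λ ()) (j≢0 ∘ suc-injective)))
∑-toℕ-pair {suc n} (suc i) {f} (s≤s si<n) others =
  trans (cong (_+ ∑[ j < n ] f (suc (toℕ j))) (others 0 z<s (λ ()) (λ ())))
        (∑-toℕ-pair i si<n (λ j j<n j≢i j≢si →
           others (suc j) (s≤s j<n) (j≢i ∘ suc-injective) (j≢si ∘ suc-injective)))

≤-∑-toℕ : ∀ {n} i (f : ℕ → ℕ) → i < n → f i ≤ ∑[ j < n ] f (toℕ j)
≤-∑-toℕ {suc n} zero    f _          = m≤m+n (f 0) _
≤-∑-toℕ {suc n} (suc i) f (s≤s i<n) = ≤-trans (≤-∑-toℕ i (f ∘ suc) i<n) (m≤n+m _ (f 0))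

if≤∣-∣+if : ∀ (b : Bool) m n → (if b then m else n) ≤ ∣ n - m ∣ + (if b then n else m)
if≤∣-∣+if true  m n = subst (λ d → m ≤ d + n) (∣-∣-comm m n) (m≤∣m-n∣+n m n)
if≤∣-∣+if false m n = m≤∣m-n∣+n n m

∣-∣≤+ : ∀ m n → ∣ m - n ∣ ≤ m + n
∣-∣≤+ m n = ≤-trans (∣m-n∣≤m⊔n m n) (m⊔n≤m+n m n)

∣-∣≤∣+-+∣+∣-∣ : ∀ a b c d → ∣ a - b ∣ ≤ ∣ a + c - b + d ∣ + ∣ c - d ∣
∣-∣≤∣+-+∣+∣-∣ a b c d = begin
  ∣ a - b ∣                             ≡⟨ ∣m+n-m+o∣≡∣n-o∣ c a b ⟨
  ∣ c + a - c + b ∣                     ≡⟨ cong₂ ∣_-_∣ (+-comm c a) (+-comm c b) ⟩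
  ∣ a + c - b + c ∣                     ≤⟨ ∣-∣-triangle (a + c) (b + d) (b + c) ⟩
  ∣ a + c - b + d ∣ + ∣ b + d - b + c ∣ ≡⟨ cong (∣ a + c - b + d ∣ +_) (trans (∣m+n-m+o∣≡∣n-o∣ b d c) (∣-∣-comm d c)) ⟩
  ∣ a + c - b + d ∣ + ∣ c - d ∣         ∎
  where open ≤-Reasoning

+≤+2* : ∀ {x y d m} → y ≤ d + x → x ≤ m → x + y ≤ d + 2 * m
+≤+2* {x} {y} {d} {m} y≤d+x x≤m = begin
  x + y        ≤⟨ +-monoʳ-≤ x y≤d+x ⟩
  x + (d + x)  ≡⟨ rearrange x d ⟩
  d + 2 * x    ≤⟨ +-monoʳ-≤ d (*-monoʳ-≤ 2 x≤m) ⟩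
  d + 2 * m    ∎
  where
  open ≤-Reasoning
  rearrange : ∀ x d → x + (d + x) ≡ d + 2 * x
  rearrange = solve-∀

∣-∣+∣-∣≤ : ∀ a b c d → ∣ a - b ∣ + ∣ c - d ∣ ≤ ∣ a + c - b + d ∣ + 2 * ((a + b) ⊓ (c + d))
∣-∣+∣-∣≤ a b c d = begin
  ∣ a - b ∣ + ∣ c - d ∣                  ≤⟨ ⊓-glb via-ab via-cd ⟩
  (D + 2 * (a + b)) ⊓ (D + 2 * (c + d))  ≡⟨ +-distribˡ-⊓ D _ _ ⟨
  D + ((2 * (a + b)) ⊓ (2 * (c + d)))    ≡⟨ cong (D +_) (*-distribˡ-⊓ 2 (a + b) (c + d)) ⟨
  D + 2 * ((a + b) ⊓ (c + d))            ∎
  where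
  open ≤-Reasoning
  D : ℕ
  D = ∣ a + c - b + d ∣
  via-ab : ∣ a - b ∣ + ∣ c - d ∣ ≤ D + 2 * (a + b)
  via-ab = +≤+2* (subst (λ e → ∣ c - d ∣ ≤ e + ∣ a - b ∣)
                        (cong₂ ∣_-_∣ (+-comm c a) (+-comm d b)) (∣-∣≤∣+-+∣+∣-∣ c d a b))
                 (∣-∣≤+ a b)
  via-cd : ∣ a - b ∣ + ∣ c - d ∣ ≤ D + 2 * (c + d)
  via-cd = subst (_≤ D + 2 * (c + d)) (+-comm ∣ c - d ∣ ∣ a - b ∣)
                 (+≤+2* (∣-∣≤∣+-+∣+∣-∣ a b c d) (∣-∣≤+ c d))

≤⇒+≡∣-∣+2*⊓ : ∀ {m n} → m ≤ n → m + n ≡ ∣ m - n ∣ + 2 * (m ⊓ n)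
≤⇒+≡∣-∣+2*⊓ {m} {n} m≤n = begin
  m + n                   ≡⟨ cong (m +_) (m+[n∸m]≡n m≤n) ⟨
  m + (m + (n ∸ m))       ≡⟨ rearrange m (n ∸ m) ⟩
  (n ∸ m) + 2 * m         ≡⟨ cong₂ (λ d k → d + 2 * k) (m≤n⇒∣m-n∣≡n∸m m≤n) (m≤n⇒m⊓n≡m m≤n) ⟨
  ∣ m - n ∣ + 2 * (m ⊓ n) ∎
  where
  open ≡-Reasoning
  rearrange : ∀ m d → m + (m + d) ≡ d + 2 * m
  rearrange = solve-∀

+≡∣-∣+2*⊓ : ∀ m n → m + n ≡ ∣ m - n ∣ + 2 * (m ⊓ n)
+≡∣-∣+2*⊓ m n with ≤-total m n
... | inj₁ m≤n = ≤⇒+≡∣-∣+2*⊓ m≤n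
... | inj₂ n≤m = trans (+-comm m n)
                   (trans (≤⇒+≡∣-∣+2*⊓ n≤m) (cong₂ (λ d k → d + 2 * k) (∣-∣-comm n m) (⊓-comm n m)))

-- 2 (x y′ + y x′) = (x + x′)(y + y′) + (x − x′)(y′ − y), and the parity term is at most x − x′.
parity-bound : ∀ {x x′ y y′} → x′ ≤ x → y < y′ →
               (x + x′) * (y + y′) + (x + x′) % 2 * ((y + y′) % 2) ≤ 2 * (x * y′ + y * x′)
parity-bound {x′ = x′} {y = y} x′≤x y<y′ with m≤n⇒∃[o]m+o≡n x′≤x | m≤n⇒∃[o]m+o≡n y<y′
... | p , refl | q , refl = begin
  a * b + a % 2 * (b % 2)                ≤⟨ +-monoʳ-≤ (a * b) (*-mono-≤ a%2≤p b%2≤1+q) ⟩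
  a * b + p * suc q                      ≡⟨ expand x′ p y q ⟨
  2 * ((x′ + p) * (suc y + q) + y * x′)  ∎
  where
  open ≤-Reasoning
  a b : ℕ
  a = x′ + p + x′
  b = y + (suc y + q)
  a%2≤p : a % 2 ≤ p
  a%2≤p = begin
    a % 2            ≡⟨ cong (_% 2) (reorder x′ p) ⟩
    (p + x′ * 2) % 2 ≡⟨ [m+kn]%n≡m%n p x′ 2 ⟩
    p % 2            ≤⟨ m%n≤m p 2 ⟩
    p                ∎
    where
    reorder : ∀ x′ p → x′ + p + x′ ≡ p + x′ * 2
    reorder = solve-∀
  b%2≤1+q : b % 2 ≤ suc q
  b%2≤1+q = ≤-trans (s≤s⁻¹ (m%n<n b 2)) (s≤s z≤n)
  expand : ∀ x′ p y q → 2 * ((x′ + p) * (suc y + q) + y * x′) ≡ (x′ + p + x′) * (y + (suc y + q)) + p * suc q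
  expand = solve-∀

HalfSplit : ℕ → ℕ → ℕ → ℕ → Set
HalfSplit a b x y = (a ≤ 2 * x × 2 * y < b) ⊎ (b ≤ 2 * y × 2 * x < a) ⊎ a ≡ 0 ⊎ b ≡ 0

halfSplit-bound : ∀ {a b x x′ y y′} → a ≡ x + x′ → b ≡ y + y′ → HalfSplit a b x y →
                  a * b + a % 2 * (b % 2) ≤ 2 * (x * y′ + y * x′)
halfSplit-bound {x = x} {x′} {y} {y′} refl refl (inj₁ (a≤2x , 2y<b)) =
  parity-bound {x} {x′} {y} {y′} (half≤ a≤2x) (half< 2y<b)
  where
  2*≡+ : ∀ m → 2 * m ≡ m + m
  2*≡+ m = cong (m +_) (+-identityʳ m)
  half≤ : ∀ {m n} → m + n ≤ 2 * m → n ≤ m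
  half≤ {m} {n} h = +-cancelˡ-≤ m n m (subst (m + n ≤_) (2*≡+ m) h)
  half< : ∀ {m n} → 2 * m < m + n → m < n
  half< {m} {n} h = +-cancelˡ-< m m n (subst (_< m + n) (2*≡+ m) h)
halfSplit-bound {x = x} {x′} {y} {y′} refl refl (inj₂ (inj₁ (b≤2y , 2x<a))) =
  subst₂ _≤_ (cong₂ _+_ (*-comm (y + y′) (x + x′)) (*-comm ((y + y′) % 2) ((x + x′) % 2)))
             (cong (2 *_) (+-comm (y * x′) (x * y′)))
             (halfSplit-bound {x = y} {y′} {x} {x′} refl refl (inj₁ (b≤2y , 2x<a)))
halfSplit-bound refl refl (inj₂ (inj₂ (inj₁ a≡0))) rewrite a≡0 = z≤n
halfSplit-bound {x = x} {x′} refl refl (inj₂ (inj₂ (inj₂ b≡0)))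
  rewrite b≡0 | *-zeroʳ (x + x′) | *-zeroʳ ((x + x′) % 2) = z≤n

-- At the least t at which one of the two counts reaches half of its total, the other count did not
-- move in the last step, so it is still below half.
crossing : ∀ (x y : ℕ → ℕ) {a b} → x 0 ≡ 0 → y 0 ≡ 0 →
           (∀ k → x (suc k) + y (suc k) ≤ suc (x k + y k)) →
           ∀ K → a ≤ 2 * x K → ∃ λ t → HalfSplit a b (x t) (y t)
crossing x y {a} {b} x₀≡0 y₀≡0 unit-steps K a≤2xK = go K (inj₁ a≤2xK)
  where
  grew : ∀ {c m n} → ¬ c ≤ 2 * m → c ≤ 2 * n → m < n
  grew {m = m} {n} c≰2m c≤2n = *-cancelˡ-< 2 m n (<-≤-trans (≰⇒> c≰2m) c≤2n)
  stayed : ∀ {x₀ x₁ y₀ y₁} → x₁ + y₁ ≤ suc (x₀ + y₀) → x₀ < x₁ → y₁ ≤ y₀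
  stayed {y₀ = y₀} {y₁} h x₀<x₁ = +-cancelˡ-≤ _ y₁ y₀ (≤-trans h (+-monoˡ-≤ y₀ x₀<x₁))
  go : ∀ k → a ≤ 2 * x k ⊎ b ≤ 2 * y k → ∃ λ t → HalfSplit a b (x t) (y t)
  go zero (inj₁ a≤) = 0 , inj₂ (inj₂ (inj₁ (n≤0⇒n≡0 (subst (λ z → a ≤ 2 * z) x₀≡0 a≤))))
  go zero (inj₂ b≤) = 0 , inj₂ (inj₂ (inj₂ (n≤0⇒n≡0 (subst (λ z → b ≤ 2 * z) y₀≡0 b≤))))
  go (suc k) reached with a ≤? 2 * x k | b ≤? 2 * y k
  ... | yes a≤ | _      = go k (inj₁ a≤)
  ... | no _   | yes b≤ = go k (inj₂ b≤)
  ... | no a≰  | no b≰  = suc k , first reached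
    where
    unit-step′ : y (suc k) + x (suc k) ≤ suc (y k + x k)
    unit-step′ = subst₂ _≤_ (+-comm (x (suc k)) _) (cong suc (+-comm (x k) _)) (unit-steps k)
    first : a ≤ 2 * x (suc k) ⊎ b ≤ 2 * y (suc k) → HalfSplit a b (x (suc k)) (y (suc k))
    first (inj₁ a≤) = inj₁ (a≤ , ≤-<-trans (*-monoʳ-≤ 2 (stayed {x k} {x (suc k)} (unit-steps k) (grew {m = x k} a≰ a≤)))
                                            (≰⇒> b≰))
    first (inj₂ b≤) = inj₂ (inj₁ (b≤ , ≤-<-trans (*-monoʳ-≤ 2 (stayed {y k} {y (suc k)} unit-step′ (grew {m = y k} b≰ b≤)))
                                                  (≰⇒> a≰)))

∣-∣≤1⇒≡∨≡suc : ∀ {j i} → ∣ j - i ∣ ≤ 1 → ∣ j - suc i ∣ ≤ 1 → j ≡ i ⊎ j ≡ suc i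
∣-∣≤1⇒≡∨≡suc {zero}  {zero}  _         _         = inj₁ refl
∣-∣≤1⇒≡∨≡suc {zero}  {suc i} _         (s≤s ())
∣-∣≤1⇒≡∨≡suc {suc j} {zero}  (s≤s j≤0) _         = inj₂ (cong suc (n≤0⇒n≡0 j≤0))
∣-∣≤1⇒≡∨≡suc {suc j} {suc i} close     close′    = Sum.map (cong suc) (cong suc) (∣-∣≤1⇒≡∨≡suc close close′)

∣-∣≤1⇒≡∨adjacent : ∀ {j k} → ∣ j - k ∣ ≤ 1 → j ≡ k ⊎ k ≡ suc j ⊎ j ≡ suc k
∣-∣≤1⇒≡∨adjacent {zero}  {zero}  _         = inj₁ refl
∣-∣≤1⇒≡∨adjacent {zero}  {suc k} (s≤s k≤0) = inj₂ (inj₁ (cong suc (n≤0⇒n≡0 k≤0)))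
∣-∣≤1⇒≡∨adjacent {suc j} {zero}  (s≤s j≤0) = inj₂ (inj₂ (cong suc (n≤0⇒n≡0 j≤0)))
∣-∣≤1⇒≡∨adjacent {suc j} {suc k} close     =
  Sum.map (cong suc) (Sum.map (cong suc) (cong suc)) (∣-∣≤1⇒≡∨adjacent close)

a-[c+k]+c≤i : ∀ {a i} c k → a ≤ i + k → ℤ.+ a ℤ.- ℤ.+ (c + k) ℤ.+ ℤ.+ c ℤ.≤ ℤ.+ i
a-[c+k]+c≤i {a} {i} c k a≤i+k = begin
  ℤ.+ a ℤ.- ℤ.+ (c + k) ℤ.+ ℤ.+ c ≡⟨ cong (ℤ._+ ℤ.+ c) (ℤ.m-n≡m⊖n a (c + k)) ⟩
  a ⊖ (c + k) ℤ.+ ℤ.+ c           ≡⟨ ℤ.distribˡ-⊖-+-pos c a (c + k) ⟩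
  (a + c) ⊖ (c + k)               ≡⟨ cong (_⊖ (c + k)) (+-comm a c) ⟩
  (c + a) ⊖ (c + k)               ≡⟨ ℤ.+-cancelˡ-⊖ c a k ⟩
  a ⊖ k                           ≤⟨ ℤ.⊖-monoˡ-≤ k a≤i+k ⟩
  (i + k) ⊖ k                     ≡⟨ ℤ.⊖-≥ (m≤n+m k i) ⟩
  ℤ.+ (i + k ∸ k)                 ≡⟨ cong ℤ.+_ (m+n∸n≡m i k) ⟩
  ℤ.+ i                           ∎
  where open ℤ.≤-Reasoning

-- Weighted digraphs cut by a threshold

cut-coefficient : ∀ ev eu w → (ev ≡ false → eu ≡ true → w ≡ 0) →
                  (𝟙 ev + 𝟙 (not eu)) * w ≡ (𝟙 (not ev) + 𝟙 eu) * w + 2 * (𝟙 ev * 𝟙 (not eu) * w)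
cut-coefficient true  true  w _    = sym (+-identityʳ _)
cut-coefficient true  false w _    = cong (2 *_) (sym (+-identityʳ w))
cut-coefficient false true  w w≡0 rewrite w≡0 refl refl = refl
cut-coefficient false false w _    = sym (+-identityʳ _)

module _ {N : ℕ} (e : Fin N → Fin N → ℕ) where

  outdeg indeg : Fin N → ℕ
  outdeg v = ∑[ u < N ] e v u
  indeg  v = ∑[ u < N ] e u v

  ∑-weighted-degrees : (a b : Fin N → ℕ) →
    ∑[ v < N ] (a v * outdeg v + b v * indeg v) ≡ ∑[ v < N ] ∑[ u < N ] ((a v + b u) * e v u)
  ∑-weighted-degrees a b = begin
    ∑[ v < N ] (a v * outdeg v + b v * indeg v)
      ≡⟨ sum-cong-≗ (λ v → cong₂ _+_ (*-distribˡ-sum (a v) (e v)) (*-distribˡ-sum (b v) (λ u → e u v))) ⟩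
    ∑[ v < N ] (∑[ u < N ] (a v * e v u) + ∑[ u < N ] (b v * e u v))
      ≡⟨ ∑-distrib-+ (λ v → ∑[ u < N ] (a v * e v u)) (λ v → ∑[ u < N ] (b v * e u v)) ⟩
    ∑[ v < N ] ∑[ u < N ] (a v * e v u) + ∑[ v < N ] ∑[ u < N ] (b v * e u v)
      ≡⟨ cong (∑[ v < N ] ∑[ u < N ] (a v * e v u) +_) (∑-comm (λ v u → b v * e u v)) ⟩
    ∑[ v < N ] ∑[ u < N ] (a v * e v u) + ∑[ v < N ] ∑[ u < N ] (b u * e v u)
      ≡⟨ ∑-distrib-+ (λ v → ∑[ u < N ] (a v * e v u)) (λ v → ∑[ u < N ] (b u * e v u)) ⟨
    ∑[ v < N ] (∑[ u < N ] (a v * e v u) + ∑[ u < N ] (b u * e v u))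
      ≡⟨ sum-cong-≗ (λ v → ∑-distrib-+ (λ u → a v * e v u) (λ u → b u * e v u)) ⟨
    ∑[ v < N ] ∑[ u < N ] (a v * e v u + b u * e v u)
      ≡⟨ sum-cong-≗ (λ v → sum-cong-≗ (λ u → *-distribʳ-+ (e v u) (a v) (b u))) ⟨
    ∑[ v < N ] ∑[ u < N ] ((a v + b u) * e v u) ∎
    where open ≡-Reasoning

  module _ (E : Fin N → Bool) where

    cut : ℕ
    cut = ∑[ v < N ] ∑[ u < N ] (𝟙 (E v) * 𝟙 (not (E u)) * e v u)

    -- An arc within one side is counted once on each side of the equation, an arc leaving E twice
    -- on the left and not at all on the right; no arc enters E.
    cut-balance : (∀ v u → E v ≡ false → E u ≡ true → e v u ≡ 0) →
      ∑[ v < N ] (if E v then outdeg v else indeg v) ≡ ∑[ v < N ] (if E v then indeg v else outdeg v) + 2 * cut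
    cut-balance no-return = begin
      ∑[ v < N ] (if E v then outdeg v else indeg v)
        ≡⟨ sum-cong-≗ (λ v → if-𝟙 (E v) (outdeg v) (indeg v)) ⟩
      ∑[ v < N ] (𝟙 (E v) * outdeg v + 𝟙 (not (E v)) * indeg v)
        ≡⟨ ∑-weighted-degrees (𝟙 ∘ E) (𝟙 ∘ not ∘ E) ⟩
      ∑[ v < N ] ∑[ u < N ] ((𝟙 (E v) + 𝟙 (not (E u))) * e v u)
        ≡⟨ sum-cong-≗ (λ v → sum-cong-≗ (λ u → cut-coefficient (E v) (E u) (e v u) (no-return v u))) ⟩
      ∑[ v < N ] ∑[ u < N ] ((𝟙 (not (E v)) + 𝟙 (E u)) * e v u + 2 * leaving v u)
        ≡⟨ sum-cong-≗ (λ v → ∑-+-*ˡ 2 (λ u → (𝟙 (not (E v)) + 𝟙 (E u)) * e v u) (leaving v)) ⟩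
      ∑[ v < N ] (∑[ u < N ] ((𝟙 (not (E v)) + 𝟙 (E u)) * e v u) + 2 * ∑[ u < N ] leaving v u)
        ≡⟨ ∑-+-*ˡ 2 (λ v → ∑[ u < N ] ((𝟙 (not (E v)) + 𝟙 (E u)) * e v u)) (λ v → ∑[ u < N ] leaving v u) ⟩
      ∑[ v < N ] ∑[ u < N ] ((𝟙 (not (E v)) + 𝟙 (E u)) * e v u) + 2 * cut
        ≡⟨ cong (_+ 2 * cut) (∑-weighted-degrees (𝟙 ∘ not ∘ E) (𝟙 ∘ E)) ⟨
      ∑[ v < N ] (𝟙 (not (E v)) * outdeg v + 𝟙 (E v) * indeg v) + 2 * cut
        ≡⟨ cong (_+ 2 * cut) (sum-cong-≗ (λ v → trans (if-𝟙 (E v) (indeg v) (outdeg v))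
                                                     (+-comm (𝟙 (E v) * indeg v) _))) ⟨
      ∑[ v < N ] (if E v then indeg v else outdeg v) + 2 * cut ∎
      where
      open ≡-Reasoning
      leaving : Fin N → Fin N → ℕ
      leaving v u = 𝟙 (E v) * 𝟙 (not (E u)) * e v u

    2*cut≤imbalance : (∀ v u → E v ≡ false → E u ≡ true → e v u ≡ 0) →
                      2 * cut ≤ ∑[ v < N ] ∣ indeg v - outdeg v ∣
    2*cut≤imbalance no-return = +-cancelʳ-≤ (sum M) (2 * cut) (∑[ v < N ] ∣ indeg v - outdeg v ∣) (begin
      2 * cut + sum M                            ≡⟨ +-comm (2 * cut) (sum M) ⟩
      sum M + 2 * cut                            ≡⟨ cut-balance no-return ⟨
      ∑[ v < N ] (if E v then outdeg v else indeg v)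
                                                 ≤⟨ sum-mono-≤ (λ v → if≤∣-∣+if (E v) (outdeg v) (indeg v)) ⟩
      ∑[ v < N ] (∣ indeg v - outdeg v ∣ + M v)  ≡⟨ ∑-distrib-+ (λ v → ∣ indeg v - outdeg v ∣) M ⟩
      ∑[ v < N ] ∣ indeg v - outdeg v ∣ + sum M  ∎)
      where
      open ≤-Reasoning
      M : Fin N → ℕ
      M v = if E v then indeg v else outdeg v

-- Graphs ordered by a permutation

module _ {N : ℕ} (G : Graph N) where

  adj⇒≢ : ∀ {v u} → adj G v u ≡ true → u ≢ v
  adj⇒≢ {v} adj≡true refl with () ← trans (sym adj≡true) (adj-irrefl G v)

  complete-bipartite-adj : ∀ {side D} → IsBipartition G side → IsCompleteBipartite G D →
                           ∀ u v → D u ≡ true → D v ≡ true → adj G u v ≡ (side u xor side v)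
  complete-bipartite-adj {side} {D} bip (A , (a , Da , Aa) , (b , Db , Ab) , adj≡xor) u v Du Dv =
    trans (adj≡xor u v Du Dv) (trans (flip-xor (A u) (A v) (side a)) (sym (cong₂ _xor_ (side≡ u Du) (side≡ v Dv))))
    where
    side-a≢side-b : side a ≢ side b
    side-a≢side-b = bip a b (trans (adj≡xor a b Da Db) (cong₂ _xor_ Aa Ab))
    side≡ : ∀ w → D w ≡ true → side w ≡ (if A w then side a else not (side a))
    side≡ w Dw with A w in Aw
    ... | true  = trans (¬-not (bip w b (trans (adj≡xor w b Dw Db) (cong₂ _xor_ Aw Ab))))
                        (sym (¬-not side-a≢side-b))
    ... | false = ¬-not (bip w a (trans (adj≡xor w a Dw Da) (cong₂ _xor_ Aw Aa)))
    flip-xor : ∀ p q c → (p xor q) ≡ ((if p then c else not c) xor (if q then c else not c))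
    flip-xor true  true  true  = refl
    flip-xor true  true  false = refl
    flip-xor true  false true  = refl
    flip-xor true  false false = refl
    flip-xor false true  true  = refl
    flip-xor false true  false = refl
    flip-xor false false true  = refl
    flip-xor false false false = refl

module _ {N : ℕ} (G : Graph N) (σ : Permutation′ N) where

  position : Fin N → ℕ
  position v = toℕ (σ ⟨$⟩ʳ v)

  position-injective : ∀ {u v} → position u ≡ position v → u ≡ v
  position-injective {u} {v} eq =
    trans (sym (inverseˡ σ)) (trans (cong (σ ⟨$⟩ˡ_) (Fin.toℕ-injective eq)) (inverseˡ σ))

  before-flip : ∀ {u v} → u ≢ v → before σ u v ≡ not (before σ v u)
  before-flip {u} {v} u≢v with before σ v u in v<u
  ... | true  = ≥⇒<ᵇ≡false {position u} (<⇒≤ (<ᵇ≡true⇒< v<u))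
  ... | false = <⇒<ᵇ≡true {position u} (≤∧≢⇒< (<ᵇ≡false⇒≥ {position v} v<u) (u≢v ∘ position-injective))

  arc : VSet N → Fin N → Fin N → ℕ
  arc D v u = 𝟙 ((D v ∧ D u) ∧ (adj G v u ∧ before σ v u))

  imbalance : VSet N → Fin N → ℕ
  imbalance D v = ∣ indeg (arc D) v - outdeg (arc D) v ∣

  indeg-arc : ∀ D v → indeg (arc D) v ≡ ∑[ u < N ] (𝟙 (D v ∧ D u) * 𝟙 (adj G v u ∧ before σ u v))
  indeg-arc D v = sum-cong-≗ λ u →
    trans (cong₂ (λ d a → 𝟙 (d ∧ (a ∧ before σ u v))) (∧-comm (D u) (D v)) (adj-sym G u v))
          (𝟙-∧ (D v ∧ D u) (adj G v u ∧ before σ u v))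

  outdeg-arc : ∀ D v → outdeg (arc D) v ≡ ∑[ u < N ] (𝟙 (D v ∧ D u) * 𝟙 (adj G v u ∧ before σ v u))
  outdeg-arc D v = sum-cong-≗ λ u → 𝟙-∧ (D v ∧ D u) (adj G v u ∧ before σ v u)

  imbalance-outside : ∀ {D v} → D v ≡ false → imbalance D v ≡ 0
  imbalance-outside {D} {v} Dv≡false = cong₂ ∣_-_∣
    (trans (indeg-arc D v) (sum-zero λ u → cong (λ d → 𝟙 (d ∧ D u) * 𝟙 (adj G v u ∧ before σ u v)) Dv≡false))
    (trans (outdeg-arc D v) (sum-zero λ u → cong (λ d → 𝟙 (d ∧ D u) * 𝟙 (adj G v u ∧ before σ v u)) Dv≡false))

  ∑-neighbour-weights : ∀ v (w : Fin N → ℕ) (L : VSet N) → (∀ u → adj G v u ≡ true → w u ≡ 1) →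
                        ∑[ u < N ] (w u * 𝟙 (adj G v u ∧ L u)) ≡ card (λ u → adj G v u ∧ L u)
  ∑-neighbour-weights v w L w≡1 = trans (sum-cong-≗ weighted) (sym (card-∑ (λ u → adj G v u ∧ L u)))
    where
    weighted : ∀ u → w u * 𝟙 (adj G v u ∧ L u) ≡ 𝟙 (adj G v u ∧ L u)
    weighted u with adj G v u in adj≡
    ... | true  = trans (cong (_* 𝟙 (L u)) (w≡1 u adj≡)) (+-identityʳ (𝟙 (L u)))
    ... | false = *-zeroʳ (w u)

  imbalance-inside : ∀ {D v} → D v ≡ true → (∀ u → adj G v u ≡ true → D u ≡ true) →
                     imbalance D v ≡ Ivert G σ v
  imbalance-inside {D} {v} Dv inside = cong₂ ∣_-_∣
    (trans (indeg-arc D v) (∑-neighbour-weights v weight (λ u → before σ u v) unit-weight))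
    (trans (outdeg-arc D v) (∑-neighbour-weights v weight (λ u → before σ v u) unit-weight))
    where
    weight : Fin N → ℕ
    weight u = 𝟙 (D v ∧ D u)
    unit-weight : ∀ u → adj G v u ≡ true → weight u ≡ 1
    unit-weight u adj≡ rewrite Dv | inside u adj≡ = refl

  indeg+outdeg : ∀ {D w} → D w ≡ true → indeg (arc D) w + outdeg (arc D) w ≡ g G w D
  indeg+outdeg {D} {w} Dw = begin
    indeg (arc D) w + outdeg (arc D) w
      ≡⟨ cong₂ _+_ (indeg-arc D w) (outdeg-arc D w) ⟩
    ∑[ u < N ] (𝟙 (D w ∧ D u) * 𝟙 (adj G w u ∧ before σ u w)) + ∑[ u < N ] (𝟙 (D w ∧ D u) * 𝟙 (adj G w u ∧ before σ w u))
      ≡⟨ ∑-distrib-+ (λ u → 𝟙 (D w ∧ D u) * 𝟙 (adj G w u ∧ before σ u w))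
                     (λ u → 𝟙 (D w ∧ D u) * 𝟙 (adj G w u ∧ before σ w u)) ⟨
    ∑[ u < N ] (𝟙 (D w ∧ D u) * 𝟙 (adj G w u ∧ before σ u w) + 𝟙 (D w ∧ D u) * 𝟙 (adj G w u ∧ before σ w u))
      ≡⟨ sum-cong-≗ pointwise ⟩
    ∑[ u < N ] 𝟙 (adj G w u ∧ D u)
      ≡⟨ card-∑ (λ u → adj G w u ∧ D u) ⟨
    g G w D ∎
    where
    open ≡-Reasoning
    pointwise : ∀ u → 𝟙 (D w ∧ D u) * 𝟙 (adj G w u ∧ before σ u w) + 𝟙 (D w ∧ D u) * 𝟙 (adj G w u ∧ before σ w u)
                      ≡ 𝟙 (adj G w u ∧ D u)
    pointwise u rewrite Dw = begin
      𝟙 (D u) * 𝟙 (adj G w u ∧ before σ u w) + 𝟙 (D u) * 𝟙 (adj G w u ∧ before σ w u)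
        ≡⟨ *-distribˡ-+ (𝟙 (D u)) _ _ ⟨
      𝟙 (D u) * (𝟙 (adj G w u ∧ before σ u w) + 𝟙 (adj G w u ∧ before σ w u))
        ≡⟨ cong (𝟙 (D u) *_) (𝟙-split-exclusive (adj G w u) _ _ (before-flip ∘ adj⇒≢ G)) ⟩
      𝟙 (D u) * 𝟙 (adj G w u)
        ≡⟨ 𝟙-∧ (D u) (adj G w u) ⟨
      𝟙 (D u ∧ adj G w u)
        ≡⟨ cong 𝟙 (∧-comm (D u) (adj G w u)) ⟩
      𝟙 (adj G w u ∧ D u) ∎

  imbalance-split : ∀ {D D′ v} → D v ≡ true → D′ v ≡ true → (∀ u → adj G v u ≡ true → D′ u ≡ not (D u)) →
                    imbalance D v + imbalance D′ v ≤ Ivert G σ v + 2 * (g G v D ⊓ g G v D′)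
  imbalance-split {D} {D′} {v} Dv D′v partition = begin
    ∣ i - o ∣ + ∣ i′ - o′ ∣                         ≤⟨ ∣-∣+∣-∣≤ i o i′ o′ ⟩
    ∣ i + i′ - o + o′ ∣ + 2 * ((i + o) ⊓ (i′ + o′)) ≡⟨ cong₂ (λ d m → d + 2 * m)
                                                        (cong₂ ∣_-_∣ (trans (cong₂ _+_ (indeg-arc D v) (indeg-arc D′ v))
                                                                            (both-sides (λ u → before σ u v)))
                                                                     (trans (cong₂ _+_ (outdeg-arc D v) (outdeg-arc D′ v))
                                                                            (both-sides (λ u → before σ v u))))
                                                        (cong₂ _⊓_ (indeg+outdeg Dv) (indeg+outdeg D′v)) ⟩
    Ivert G σ v + 2 * (g G v D ⊓ g G v D′)          ∎
    where
    open ≤-Reasoning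
    i o i′ o′ : ℕ
    i  = indeg (arc D) v
    o  = outdeg (arc D) v
    i′ = indeg (arc D′) v
    o′ = outdeg (arc D′) v
    weight : Fin N → ℕ
    weight u = 𝟙 (D v ∧ D u) + 𝟙 (D′ v ∧ D′ u)
    unit-weight : ∀ u → adj G v u ≡ true → weight u ≡ 1
    unit-weight u adj≡ rewrite Dv | D′v | partition u adj≡ = 𝟙+𝟙-not (D u)
    both-sides : ∀ (L : VSet N) →
      ∑[ u < N ] (𝟙 (D v ∧ D u) * 𝟙 (adj G v u ∧ L u)) + ∑[ u < N ] (𝟙 (D′ v ∧ D′ u) * 𝟙 (adj G v u ∧ L u))
        ≡ card (λ u → adj G v u ∧ L u)
    both-sides L = begin-equality
      ∑[ u < N ] (𝟙 (D v ∧ D u) * 𝟙 (adj G v u ∧ L u)) + ∑[ u < N ] (𝟙 (D′ v ∧ D′ u) * 𝟙 (adj G v u ∧ L u))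
        ≡⟨ ∑-distrib-+ (λ u → 𝟙 (D v ∧ D u) * 𝟙 (adj G v u ∧ L u)) (λ u → 𝟙 (D′ v ∧ D′ u) * 𝟙 (adj G v u ∧ L u)) ⟨
      ∑[ u < N ] (𝟙 (D v ∧ D u) * 𝟙 (adj G v u ∧ L u) + 𝟙 (D′ v ∧ D′ u) * 𝟙 (adj G v u ∧ L u))
        ≡⟨ sum-cong-≗ (λ u → *-distribʳ-+ (𝟙 (adj G v u ∧ L u)) (𝟙 (D v ∧ D u)) (𝟙 (D′ v ∧ D′ u))) ⟨
      ∑[ u < N ] (weight u * 𝟙 (adj G v u ∧ L u))
        ≡⟨ ∑-neighbour-weights v weight L unit-weight ⟩
      card (λ u → adj G v u ∧ L u) ∎

  early : ℕ → Fin N → Bool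
  early t v = position v <ᵇ t

  countBefore countAfter : VSet N → ℕ → ℕ
  countBefore P t = ∑[ v < N ] 𝟙 (early t v ∧ P v)
  countAfter  P t = ∑[ v < N ] 𝟙 (not (early t v) ∧ P v)

  card≡before+after : ∀ P t → card P ≡ countBefore P t + countAfter P t
  card≡before+after P t =
    trans (card-∑ P) (trans (sum-cong-≗ split) (∑-distrib-+ (λ v → 𝟙 (early t v ∧ P v)) (λ v → 𝟙 (not (early t v) ∧ P v))))
    where
    split : ∀ v → 𝟙 (P v) ≡ 𝟙 (early t v ∧ P v) + 𝟙 (not (early t v) ∧ P v)
    split v with early t v
    ... | true  = sym (+-identityʳ (𝟙 (P v)))
    ... | false = refl

  countBefore-zero : ∀ P → countBefore P 0 ≡ 0
  countBefore-zero P = sum-zero {f = λ v → 𝟙 (early 0 v ∧ P v)} (λ _ → refl)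

  countBefore-all : ∀ P → countBefore P N ≡ card P
  countBefore-all P = trans (sum-cong-≗ (λ v → cong (λ b → 𝟙 (b ∧ P v)) (<⇒<ᵇ≡true (Fin.toℕ<n (σ ⟨$⟩ʳ v)))))
                            (sym (card-∑ P))

  countBefore-∩+∩∁ : ∀ D S t → countBefore (D ∩ S) t + countBefore (D ∩ ∁ S) t ≡ countBefore D t
  countBefore-∩+∩∁ D S t = trans (sym (∑-distrib-+ (λ v → 𝟙 (early t v ∧ (D ∩ S) v)) (λ v → 𝟙 (early t v ∧ (D ∩ ∁ S) v))))
                                 (sum-cong-≗ λ v → sides (early t v) (D v) (S v))
    where
    sides : ∀ e d s → 𝟙 (e ∧ (d ∧ s)) + 𝟙 (e ∧ (d ∧ not s)) ≡ 𝟙 (e ∧ d)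
    sides e d s = trans (cong₂ _+_ (cong 𝟙 (sym (∧-assoc e d s))) (cong 𝟙 (sym (∧-assoc e d (not s)))))
                        (𝟙-split-exclusive (e ∧ d) s (not s) (λ _ → sym (not-involutive s)))

  countBefore-suc : ∀ P t → countBefore P (suc t) ≤ suc (countBefore P t)
  countBefore-suc P t = begin
    countBefore P (suc t)                                   ≤⟨ sum-mono-≤ pointwise ⟩
    ∑[ v < N ] (𝟙 (early t v ∧ P v) + 𝟙 (position v ≡ᵇ t))  ≡⟨ ∑-distrib-+ (λ v → 𝟙 (early t v ∧ P v)) (λ v → 𝟙 (position v ≡ᵇ t)) ⟩
    countBefore P t + ∑[ v < N ] 𝟙 (position v ≡ᵇ t)        ≤⟨ +-monoʳ-≤ (countBefore P t) (unique⇒∑𝟙≤1 (λ v → position v ≡ᵇ t) at-t) ⟩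
    countBefore P t + 1                                     ≡⟨ +-comm (countBefore P t) 1 ⟩
    suc (countBefore P t)                                   ∎
    where
    open ≤-Reasoning
    pointwise : ∀ v → 𝟙 (early (suc t) v ∧ P v) ≤ 𝟙 (early t v ∧ P v) + 𝟙 (position v ≡ᵇ t)
    pointwise v = subst (λ b → 𝟙 (b ∧ P v) ≤ 𝟙 (early t v ∧ P v) + 𝟙 (position v ≡ᵇ t))
                        (sym (<ᵇ-suc (position v) t)) (𝟙-∨-∧ (early t v) _ (P v))
    at-t : ∀ u v → (position u ≡ᵇ t) ≡ true → (position v ≡ᵇ t) ≡ true → u ≡ v
    at-t u v u≡t v≡t = position-injective (trans (≡ᵇ⇒≡ _ t (Equivalence.from T-≡ u≡t))
                                                 (sym (≡ᵇ⇒≡ _ t (Equivalence.from T-≡ v≡t))))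

  early-before : ∀ {t v u} → early t v ≡ true → early t u ≡ false → before σ v u ≡ true
  early-before {t} {v} {u} ev eu =
    <⇒<ᵇ≡true {position v} (<-≤-trans (<ᵇ≡true⇒< {position v} {t} ev) (<ᵇ≡false⇒≥ {position u} {t} eu))

  arc-late-early : ∀ {D t v u} → early t v ≡ false → early t u ≡ true → arc D v u ≡ 0
  arc-late-early {D} {t} {v} {u} ev eu = cong 𝟙 (begin
    (D v ∧ D u) ∧ (adj G v u ∧ before σ v u) ≡⟨ cong (λ b → (D v ∧ D u) ∧ (adj G v u ∧ b)) v-after-u ⟩
    (D v ∧ D u) ∧ (adj G v u ∧ false)        ≡⟨ cong ((D v ∧ D u) ∧_) (∧-zeroʳ (adj G v u)) ⟩
    (D v ∧ D u) ∧ false                      ≡⟨ ∧-zeroʳ (D v ∧ D u) ⟩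
    false                                    ∎)
    where
    open ≡-Reasoning
    v-after-u : before σ v u ≡ false
    v-after-u = ≥⇒<ᵇ≡false {position v} (<⇒≤ (<-≤-trans (<ᵇ≡true⇒< {position u} {t} eu) (<ᵇ≡false⇒≥ {position v} {t} ev)))

  module _ {D side : VSet N} (adj≡xor : ∀ u v → D u ≡ true → D v ≡ true → adj G u v ≡ (side u xor side v)) where

    arc-early-late : ∀ t v u →
      𝟙 (early t v) * 𝟙 (not (early t u)) * arc D v u
        ≡ 𝟙 (early t v ∧ (D ∩ side) v) * 𝟙 (not (early t u) ∧ (D ∩ ∁ side) u)
          + 𝟙 (early t v ∧ (D ∩ ∁ side) v) * 𝟙 (not (early t u) ∧ (D ∩ side) u)
    arc-early-late t v u with early t v in ev | early t u in eu
    ... | false | _     = refl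
    ... | true  | true  = sym (cong₂ _+_ (*-zeroʳ (𝟙 ((D ∩ side) v))) (*-zeroʳ (𝟙 ((D ∩ ∁ side) v))))
    ... | true  | false = begin
      arc D v u + 0                                 ≡⟨ +-identityʳ (arc D v u) ⟩
      𝟙 ((D v ∧ D u) ∧ (adj G v u ∧ before σ v u))  ≡⟨ cong (λ b → 𝟙 ((D v ∧ D u) ∧ (adj G v u ∧ b))) (early-before {t} ev eu) ⟩
      𝟙 ((D v ∧ D u) ∧ (adj G v u ∧ true))          ≡⟨ cong (λ a → 𝟙 ((D v ∧ D u) ∧ a)) (∧-identityʳ (adj G v u)) ⟩
      𝟙 ((D v ∧ D u) ∧ adj G v u)                   ≡⟨ 𝟙-xor-split (D v) (D u) (side v) (side u) (adj G v u) (adj≡xor v u) ⟩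
      𝟙 ((D ∩ side) v) * 𝟙 ((D ∩ ∁ side) u) + 𝟙 ((D ∩ ∁ side) v) * 𝟙 ((D ∩ side) u) ∎
      where open ≡-Reasoning

    cut-size : ∀ t → cut (arc D) (early t)
                     ≡ countBefore (D ∩ side) t * countAfter (D ∩ ∁ side) t + countBefore (D ∩ ∁ side) t * countAfter (D ∩ side) t
    cut-size t = begin
      ∑[ v < N ] ∑[ u < N ] (𝟙 (early t v) * 𝟙 (not (early t u)) * arc D v u)
        ≡⟨ sum-cong-≗ (λ v → sum-cong-≗ (arc-early-late t v)) ⟩
      ∑[ v < N ] ∑[ u < N ] (x v * y′ u + y v * x′ u)
        ≡⟨ sum-cong-≗ (λ v → ∑-distrib-+ (λ u → x v * y′ u) (λ u → y v * x′ u)) ⟩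
      ∑[ v < N ] (∑[ u < N ] (x v * y′ u) + ∑[ u < N ] (y v * x′ u))
        ≡⟨ ∑-distrib-+ (λ v → ∑[ u < N ] (x v * y′ u)) (λ v → ∑[ u < N ] (y v * x′ u)) ⟩
      ∑[ v < N ] ∑[ u < N ] (x v * y′ u) + ∑[ v < N ] ∑[ u < N ] (y v * x′ u)
        ≡⟨ cong₂ _+_ (∑∑-* x y′) (∑∑-* y x′) ⟩
      sum x * sum y′ + sum y * sum x′ ∎
      where
      open ≡-Reasoning
      x y x′ y′ : Fin N → ℕ
      x  v = 𝟙 (early t v ∧ (D ∩ side) v)
      y  v = 𝟙 (early t v ∧ (D ∩ ∁ side) v)
      x′ v = 𝟙 (not (early t v) ∧ (D ∩ side) v)
      y′ v = 𝟙 (not (early t v) ∧ (D ∩ ∁ side) v)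

  complete-bipartite-imbalance : ∀ {side D} → IsBipartition G side → IsCompleteBipartite G D →
    sizeX side D * sizeY side D + sizeX side D % 2 * (sizeY side D % 2) ≤ ∑[ v < N ] imbalance D v
  complete-bipartite-imbalance {side} {D} bip cb =
    at-threshold (crossing (countBefore X) (countBefore Y) (countBefore-zero X) (countBefore-zero Y) unit-steps N all-early)
    where
    X Y : VSet N
    X = D ∩ side
    Y = D ∩ ∁ side
    unit-steps : ∀ k → countBefore X (suc k) + countBefore Y (suc k) ≤ suc (countBefore X k + countBefore Y k)
    unit-steps k = subst₂ _≤_ (sym (countBefore-∩+∩∁ D side (suc k))) (cong suc (sym (countBefore-∩+∩∁ D side k)))
                          (countBefore-suc D k)
    all-early : card X ≤ 2 * countBefore X N
    all-early = subst (λ c → card X ≤ 2 * c) (sym (countBefore-all X)) (m≤m+n (card X) (card X + 0))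
    at-threshold : (∃ λ t → HalfSplit (card X) (card Y) (countBefore X t) (countBefore Y t)) →
                   card X * card Y + card X % 2 * (card Y % 2) ≤ ∑[ v < N ] imbalance D v
    at-threshold (t , half-split) = begin
      card X * card Y + card X % 2 * (card Y % 2)
        ≤⟨ halfSplit-bound {x = countBefore X t} {countAfter X t} {countBefore Y t} {countAfter Y t}
                           (card≡before+after X t) (card≡before+after Y t) half-split ⟩
      2 * (countBefore X t * countAfter Y t + countBefore Y t * countAfter X t)
        ≡⟨ cong (2 *_) (cut-size (complete-bipartite-adj G bip cb) t) ⟨
      2 * cut (arc D) (early t)
        ≤⟨ 2*cut≤imbalance (arc D) (early t) (λ v u → arc-late-early {D} {t} {v} {u}) ⟩
      ∑[ v < N ] imbalance D v ∎
      where open ≤-Reasoning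

-- Chains of complete bipartite components

module Chain {N : ℕ} (G : Graph N) (σ : Permutation′ N) (n : ℕ) (C : ℕ → VSet N) (s : ℕ → Fin N)
             (chained : IsChained G n C s) where

  covered : ∀ u v → adj G u v ≡ true → ∃ λ i → i < n × C i u ≡ true × C i v ≡ true
  covered = proj₁ (proj₁ chained)

  linked : ∀ i → suc i < n → ∀ v → ((C i v ∧ C (suc i) v) ≡ true → v ≡ s i) × (v ≡ s i → (C i v ∧ C (suc i) v) ≡ true)
  linked = proj₁ (proj₂ chained)

  link-in-both : ∀ {i} → suc i < n → C i (s i) ≡ true × C (suc i) (s i) ≡ true
  link-in-both {i} si<n = ∧-true (proj₂ (linked i si<n (s i)) refl)

  members-close : ∀ {v j k} → j < n → k < n → C j v ≡ true → C k v ≡ true → ∣ j - k ∣ ≤ 1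
  members-close {v} {j} {k} j<n k<n Cjv Ckv =
    ≮⇒≥ λ far → true≢false (trans (sym (cong₂ _∧_ Cjv Ckv)) (proj₂ (proj₂ chained) j k j<n k<n far v))
    where
    true≢false : true ≢ false
    true≢false ()

  link-members : ∀ {i j} → suc i < n → j < n → C j (s i) ≡ true → j ≡ i ⊎ j ≡ suc i
  link-members {i} si<n j<n Cj =
    ∣-∣≤1⇒≡∨≡suc (members-close j<n (<-trans (n<1+n i) si<n) Cj (proj₁ (link-in-both si<n)))
                 (members-close j<n si<n Cj (proj₂ (link-in-both si<n)))

  sole-member : ∀ {v j k} → (∀ i → suc i < n → v ≢ s i) → j < n → k < n → C j v ≡ true → C k v ≡ true → j ≡ k
  sole-member {v} {j} {k} off-links j<n k<n Cjv Ckv with ∣-∣≤1⇒≡∨adjacent (members-close j<n k<n Cjv Ckv)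
  ... | inj₁ j≡k         = j≡k
  ... | inj₂ (inj₁ refl) = ⊥-elim (off-links j k<n (proj₁ (linked j k<n v) (cong₂ _∧_ Cjv Ckv)))
  ... | inj₂ (inj₂ refl) = ⊥-elim (off-links k j<n (proj₁ (linked k j<n v) (cong₂ _∧_ Ckv Cjv)))

  link-partition : ∀ {i} → suc i < n → ∀ u → adj G (s i) u ≡ true → C (suc i) u ≡ not (C i u)
  link-partition {i} si<n u adj≡ = exactly-one some not-both
    where
    some : C i u ≡ true ⊎ C (suc i) u ≡ true
    some with covered (s i) u adj≡
    ... | j , j<n , Cjs , Cju with link-members si<n j<n Cjs
    ...   | inj₁ refl = inj₁ Cju
    ...   | inj₂ refl = inj₂ Cju
    not-both : ¬ (C i u ∧ C (suc i) u) ≡ true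
    not-both both = adj⇒≢ G adj≡ (proj₁ (linked i si<n u) both)

  linkMin : ℕ → ℕ
  linkMin i = g G (s i) (C i) ⊓ g G (s i) (C (suc i))

  linkCorrection : Fin N → ℕ
  linkCorrection v = ∑[ i < n ∸ 1 ] (𝟙 (does (v ≟ s (toℕ i))) * linkMin (toℕ i))

  linkMin≤linkCorrection : ∀ {i} → suc i < n → linkMin i ≤ linkCorrection (s i)
  linkMin≤linkCorrection {i} si<n = subst (_≤ linkCorrection (s i)) at-i
    (≤-∑-toℕ i (λ k → 𝟙 (does (s i ≟ s k)) * linkMin k) (∸-monoˡ-≤ 1 si<n))
    where
    at-i : 𝟙 (does (s i ≟ s i)) * linkMin i ≡ linkMin i
    at-i = trans (cong (λ b → 𝟙 b * linkMin i) (dec-true (s i ≟ s i) refl)) (+-identityʳ (linkMin i))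

  ∑-linkCorrection : ∑[ v < N ] linkCorrection v ≡ ∑[ i < n ∸ 1 ] linkMin (toℕ i)
  ∑-linkCorrection = trans (∑-comm {N} {n ∸ 1} (λ v i → 𝟙 (does (v ≟ s (toℕ i))) * linkMin (toℕ i)))
                           (sum-cong-≗ {n ∸ 1} {x = λ i → ∑[ v < N ] (𝟙 (does (v ≟ s (toℕ i))) * linkMin (toℕ i))}
                             λ i → point-mass (s (toℕ i)) (linkMin (toℕ i)))
    where
    point-mass : ∀ w m → ∑[ v < N ] (𝟙 (does (v ≟ w)) * m) ≡ m
    point-mass w m = trans (sum-single w λ v v≢w → cong (λ b → 𝟙 b * m) (dec-false (v ≟ w) v≢w))
                           (trans (cong (λ b → 𝟙 b * m) (dec-true (w ≟ w) refl)) (+-identityʳ m))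

  imbalance-at-link : ∀ {i} → suc i < n →
    ∑[ j < n ] imbalance G σ (C (toℕ j)) (s i) ≤ Ivert G σ (s i) + 2 * linkCorrection (s i)
  imbalance-at-link {i} si<n = begin
    ∑[ j < n ] imbalance G σ (C (toℕ j)) (s i)
      ≡⟨ ∑-toℕ-pair i {λ j → imbalance G σ (C j) (s i)} si<n (λ j j<n j≢i j≢si →
           imbalance-outside G σ {C j} (¬-not λ Cj → [ j≢i , j≢si ]′ (link-members si<n j<n Cj))) ⟩
    imbalance G σ (C i) (s i) + imbalance G σ (C (suc i)) (s i)
      ≤⟨ imbalance-split G σ (proj₁ (link-in-both si<n)) (proj₂ (link-in-both si<n)) (link-partition si<n) ⟩
    Ivert G σ (s i) + 2 * linkMin i
      ≤⟨ +-monoʳ-≤ (Ivert G σ (s i)) (*-monoʳ-≤ 2 (linkMin≤linkCorrection si<n)) ⟩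
    Ivert G σ (s i) + 2 * linkCorrection (s i) ∎
    where open ≤-Reasoning

  imbalance-off-links : ∀ {v} → (∀ i → suc i < n → v ≢ s i) →
    ∑[ j < n ] imbalance G σ (C (toℕ j)) v ≤ Ivert G σ v
  imbalance-off-links {v} off-links with anyUpTo? (λ j → C j v Bool.≟ true) n
  ... | yes (i , i<n , Civ) = ≤-reflexive (begin
    ∑[ j < n ] imbalance G σ (C (toℕ j)) v
      ≡⟨ ∑-toℕ-single i {λ j → imbalance G σ (C j) v} i<n (λ j j<n j≢i →
           imbalance-outside G σ {C j} (¬-not λ Cjv → j≢i (sole-member off-links j<n i<n Cjv Civ))) ⟩
    imbalance G σ (C i) v
      ≡⟨ imbalance-inside G σ Civ neighbours-inside ⟩
    Ivert G σ v ∎)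
    where
    open ≡-Reasoning
    neighbours-inside : ∀ u → adj G v u ≡ true → C i u ≡ true
    neighbours-inside u adj≡ with covered v u adj≡
    ... | j , j<n , Cjv , Cju = subst (λ k → C k u ≡ true) (sole-member off-links j<n i<n Cjv Civ) Cju
  ... | no outside = ≤-trans (≤-reflexive (sum-zero λ j →
                       imbalance-outside G σ {C (toℕ j)} (¬-not λ Cjv → outside (toℕ j , Fin.toℕ<n j , Cjv)))) z≤n

  vertex-bound : ∀ v → ∑[ j < n ] imbalance G σ (C (toℕ j)) v ≤ Ivert G σ v + 2 * linkCorrection v
  vertex-bound v with anyUpTo? (λ i → (suc i <? n) ×-dec (v ≟ s i)) n
  ... | yes (i , _ , si<n , refl) = imbalance-at-link si<n
  ... | no off-link = ≤-trans (imbalance-off-links (λ i si<n v≡si → off-link (i , <-trans (n<1+n i) si<n , si<n , v≡si)))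
                              (m≤m+n (Ivert G σ v) _)

  chain-bound : ∀ {side} → IsBipartition G side →
    sumTo n (λ i → sizeX side (C i) * sizeY side (C i) + sizeX side (C i) % 2 * (sizeY side (C i) % 2))
      ≤ Iord G σ + 2 * ∑[ i < n ∸ 1 ] linkMin (toℕ i)
  chain-bound {side} bip = begin
    sumTo n (λ i → sizeX side (C i) * sizeY side (C i) + sizeX side (C i) % 2 * (sizeY side (C i) % 2))
      ≡⟨ sumTo-∑ n (λ i → sizeX side (C i) * sizeY side (C i) + sizeX side (C i) % 2 * (sizeY side (C i) % 2)) ⟩
    ∑[ j < n ] (sizeX side (C (toℕ j)) * sizeY side (C (toℕ j)) + sizeX side (C (toℕ j)) % 2 * (sizeY side (C (toℕ j)) % 2))
      ≤⟨ sum-mono-≤ (λ j → complete-bipartite-imbalance G σ bip (proj₁ (proj₂ (proj₁ chained)) (toℕ j) (Fin.toℕ<n j))) ⟩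
    ∑[ j < n ] ∑[ v < N ] imbalance G σ (C (toℕ j)) v
      ≡⟨ ∑-comm {n} {N} (λ j v → imbalance G σ (C (toℕ j)) v) ⟩
    ∑[ v < N ] ∑[ j < n ] imbalance G σ (C (toℕ j)) v
      ≤⟨ sum-mono-≤ vertex-bound ⟩
    ∑[ v < N ] (Ivert G σ v + 2 * linkCorrection v)
      ≡⟨ ∑-+-*ˡ 2 (Ivert G σ) linkCorrection ⟩
    ∑[ v < N ] Ivert G σ v + 2 * ∑[ v < N ] linkCorrection v
      ≡⟨ cong₂ (λ I c → I + 2 * c) (sym (sum-allFin (Ivert G σ))) ∑-linkCorrection ⟩
    Iord G σ + 2 * ∑[ i < n ∸ 1 ] linkMin (toℕ i) ∎
    where open ≤-Reasoning

  linkGap : ℕ → ℕ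
  linkGap i = ∣ g G (s i) (C i) - g G (s i) (C (suc i)) ∣

  link-degrees : sumTo (n ∸ 1) (λ i → g G (s i) (C i) + g G (s i) (C (suc i)))
                 ≡ sumTo (n ∸ 1) linkGap + 2 * ∑[ i < n ∸ 1 ] linkMin (toℕ i)
  link-degrees = begin
    sumTo (n ∸ 1) (λ i → g G (s i) (C i) + g G (s i) (C (suc i)))
      ≡⟨ sumTo-∑ (n ∸ 1) (λ i → g G (s i) (C i) + g G (s i) (C (suc i))) ⟩
    ∑[ i < n ∸ 1 ] (g G (s (toℕ i)) (C (toℕ i)) + g G (s (toℕ i)) (C (suc (toℕ i))))
      ≡⟨ sum-cong-≗ {n ∸ 1} (λ i → +≡∣-∣+2*⊓ (g G (s (toℕ i)) (C (toℕ i))) (g G (s (toℕ i)) (C (suc (toℕ i))))) ⟩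
    ∑[ i < n ∸ 1 ] (linkGap (toℕ i) + 2 * linkMin (toℕ i))
      ≡⟨ ∑-+-*ˡ {n ∸ 1} 2 (linkGap ∘ toℕ) (linkMin ∘ toℕ) ⟩
    ∑[ i < n ∸ 1 ] linkGap (toℕ i) + 2 * ∑[ i < n ∸ 1 ] linkMin (toℕ i)
      ≡⟨ cong (_+ 2 * ∑[ i < n ∸ 1 ] linkMin (toℕ i)) (sumTo-∑ (n ∸ 1) linkGap) ⟨
    sumTo (n ∸ 1) linkGap + 2 * ∑[ i < n ∸ 1 ] linkMin (toℕ i) ∎
    where open ≡-Reasoning

lemma7 : ∀ {N : ℕ} (G : Graph N) → Connected G →
           (side : Fin N → Bool) → IsBipartition G side →
           (n : ℕ) (C : ℕ → Fin N → Bool) (s : ℕ → Fin N) → IsChained G n C s →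
           (σ : Permutation′ N) →
           ((ℤ.+ sumTo n (λ i → sizeX side (C i) ℕ.* sizeY side (C i) ℕ.+ (sizeX side (C i) % 2) ℕ.* (sizeY side (C i) % 2)))
             ℤ.- (ℤ.+ sumTo (n ∸ 1) (λ i → g G (s i) (C i) ℕ.+ g G (s i) (C (suc i)))))
             ℤ.+ (ℤ.+ sumTo (n ∸ 1) (λ i → ∣ g G (s i) (C i) - g G (s i) (C (suc i)) ∣))
           ℤ.≤ ℤ.+ Iord G σ
lemma7 G _ side bip n C s chained σ =
  subst (λ T → ℤ.+ sumTo n component ℤ.- ℤ.+ T ℤ.+ ℤ.+ sumTo (n ∸ 1) linkGap ℤ.≤ ℤ.+ Iord G σ)
        (sym link-degrees) (a-[c+k]+c≤i (sumTo (n ∸ 1) linkGap) _ (chain-bound bip))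
  where
  open Chain G σ n C s chained
  component : ℕ → ℕ
  component i = sizeX side (C i) * sizeY side (C i) + sizeX side (C i) % 2 * (sizeY side (C i) % 2)
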